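{- Let $T$ be an unlabeled binary tree with $n$ nodes. Among all permutations $\sigma\in S_n$ whose binary search tree $\mathrm{bst}(\sigma)$ has shape $T$ (the sylvester class of $T$), the greatest one for the lexicographic order is the canonical word $w_T$.
   Context: Permutations of $S_n$ are viewed as words on $\{1<2<\dots<n\}$. A binary tree is either empty or a node with left and right (possibly empty) subtrees; its shape is the underlying unlabeled tree. For a word $w$, $\mathrm{bst}(w)$ is obtained by reading $w$ from right to left and inserting each letter $x$ into the current tree: into an empty tree create a node labeled $x$; otherwise insert recursively into the left subtree if $x\le$ root label, into the right subtree if $x>$ root label. For an unlabeled binary tree $T$ with $n$ nodes there is a unique labeling of its nodes by $1,\dots,n$ such that each label is greater than all labels of its left subtree and smaller than all labels of its right subtree; $w_T$ is the right-to-left postfix reading of this labeled tree (recursively read the right subtree, then the left subtree, then the root). -}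

module Defs where

open import Data.Nat using (ℕ; zero; suc; _+_; _≤_; _<_; _≤ᵇ_)
open import Data.Bool using (if_then_else_)
open import Data.Product using (_×_)
open import Data.List using (List; []; _∷_; _++_; foldr; map; upTo)
open import Data.List.Relation.Binary.Permutation.Propositional using (_↭_)
open import Relation.Binary.PropositionalEquality using (_≡_)

data Tree : Set where
  leaf : Tree
  node : Tree → Tree → Tree

size : Tree → ℕ
size leaf = 0
size (node l r) = size l + 1 + size r

data LTree : Set where
  lleaf : LTree
  lnode : LTree → ℕ → LTree → LTree

shape : LTree → Tree
shape lleaf = leaf
shape (lnode l _ r) = node (shape l) (shape r)

insert : ℕ → LTree → LTree
insert x lleaf = lnode lleaf x lleaf
insert x (lnode l y r) = if x ≤ᵇ y then lnode (insert x l) y r else lnode l y (insert x r)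

bst : List ℕ → LTree
bst w = foldr insert lleaf w

-- the unique in-order (binary search) labeling of T using labels k+1, ..., k+size T
label : ℕ → Tree → LTree
label k leaf = lleaf
label k (node l r) = lnode (label k l) (k + size l + 1) (label (k + size l + 1) r)

postfixRL : LTree → List ℕ
postfixRL lleaf = []
postfixRL (lnode l x r) = postfixRL r ++ postfixRL l ++ (x ∷ [])

wT : Tree → List ℕ
wT T = postfixRL (label 0 T)

IsPerm : ℕ → List ℕ → Set
IsPerm n σ = σ ↭ map suc (upTo n)

InClass : Tree → List ℕ → Set
InClass T σ = IsPerm (size T) σ × shape (bst σ) ≡ T


data _≤lex_ : List ℕ → List ℕ → Set where
  []≤    : ∀ {v} → [] ≤lex v
  head<  : ∀ {x y u v} → x < y → (x ∷ u) ≤lex (y ∷ v)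
  head≡  : ∀ {x u v} → u ≤lex v → (x ∷ u) ≤lex (x ∷ v)

-- The last letter x of a word ys x is the root of its binary search tree, whose left and right
-- subtrees are the trees of the letters of ys that are ≤ x and > x. If the word is a permutation
-- of k+1, …, k+n and its tree has shape node L R, exactly size L letters lie below x, so
-- x = k + size L + 1, and by induction the tree is the in-order labelling of the shape. Within the
-- class of a labelled tree t, w_t = w_R w_L x is lexicographically greatest: by induction the
-- letters > x and ≤ x of ys are dominated by w_R and w_L, and since every letter of w_R exceeds x,
-- interleaving small letters into the large ones only makes the word smaller.
module Submission where

open import Defs
open import Data.Nat using (ℕ; zero; suc; _+_; _≤_; _<_; _≤ᵇ_; s≤s)
open import Data.List using (List; []; _∷_; _++_; _∷ʳ_; [_]; foldr; filter; map; upTo; applyUpTo; length; initLast; _∷ʳ′_)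
open import Data.Product using (_×_; _,_; ∃₂)
open import Data.Bool using (true; false)
open import Data.Nat.Properties
  using (_≤?_; +-identityʳ; +-suc; +-comm; n<1+n; <-trans; ≤-trans; ≤-<-trans; m≤m+n; <⇒≱; ≰⇒>; ≤ᵇ-reflects-≤; suc-injective)
open import Data.List.Properties using (++-assoc; ++-identityʳ; length-++; foldr-++; filter-++; filter-all; filter-none; map-upTo)
open import Data.List.Relation.Unary.All as All using (All; []; _∷_)
open import Data.List.Relation.Unary.All.Properties using (all-filter)
open import Data.List.Relation.Unary.Any using (here; there)
open import Data.List.Membership.Propositional using (_∈_)
open import Data.List.Membership.Propositional.Properties using (∈-++⁺ʳ)
open import Data.List.Relation.Binary.Permutation.Propositional
  using (_↭_; prep; ↭-refl; ↭-sym; ↭-trans; module PermutationReasoning)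
open import Data.List.Relation.Binary.Permutation.Propositional.Properties
  using (++⁺ˡ; ++⁺ʳ; shift; drop-mid; ++-comm; ++⁺; All-resp-↭; ∈-resp-↭; ↭-length; filter-↭)
open import Relation.Unary.Properties using (∁?)
open import Relation.Nullary.Reflects using (ofʸ)
open import Relation.Binary.PropositionalEquality
  using (_≡_; refl; sym; trans; cong; cong₂; subst; module ≡-Reasoning)

-- above negates _≤?_ rather than using _<?_, so that both filters branch on x ≤ᵇ r
-- definitionally, exactly as insert does.
atMost above : ℕ → List ℕ → List ℕ
atMost x = filter (_≤? x)
above x = filter (∁? (_≤? x))

lnode-injective : ∀ {l x u l′ x′ u′} → lnode l x u ≡ lnode l′ x′ u′ → l ≡ l′ × x ≡ x′ × u ≡ u′
lnode-injective refl = refl , refl , refl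

node-injective : ∀ {l u l′ u′} → node l u ≡ node l′ u′ → l ≡ l′ × u ≡ u′
node-injective refl = refl , refl

foldr-insert-lnode : ∀ xs l r u → foldr insert (lnode l r u) xs
                   ≡ lnode (foldr insert l (atMost r xs)) r (foldr insert u (above r xs))
foldr-insert-lnode []       l r u = refl
foldr-insert-lnode (x ∷ xs) l r u rewrite foldr-insert-lnode xs l r u with x ≤ᵇ r
... | true  = refl
... | false = refl

bst-∷ʳ : ∀ ys x → bst (ys ∷ʳ x) ≡ lnode (bst (atMost x ys)) x (bst (above x ys))
bst-∷ʳ ys x = trans (foldr-++ insert lleaf ys [ x ]) (foldr-insert-lnode ys lleaf x lleaf)

postfixRL-insert : ∀ x t → postfixRL (insert x t) ↭ x ∷ postfixRL t
postfixRL-insert x lleaf = ↭-refl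
postfixRL-insert x (lnode l y u) with x ≤ᵇ y
... | true  = ↭-trans (++⁺ˡ (postfixRL u) (++⁺ʳ [ y ] (postfixRL-insert x l)))
                      (shift x (postfixRL u) (postfixRL l ++ [ y ]))
... | false = ++⁺ʳ (postfixRL l ++ [ y ]) (postfixRL-insert x u)

postfixRL-bst : ∀ w → postfixRL (bst w) ↭ w
postfixRL-bst []      = ↭-refl
postfixRL-bst (x ∷ w) = ↭-trans (postfixRL-insert x (bst w)) (prep x (postfixRL-bst w))

length-postfixRL : ∀ t → length (postfixRL t) ≡ size (shape t)
length-postfixRL lleaf = refl
length-postfixRL (lnode l x u) = begin
  length (postfixRL u ++ postfixRL l ++ [ x ])            ≡⟨ length-++ (postfixRL u) ⟩
  length (postfixRL u) + length (postfixRL l ++ [ x ])    ≡⟨ cong (length (postfixRL u) +_) (length-++ (postfixRL l)) ⟩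
  length (postfixRL u) + (length (postfixRL l) + 1)       ≡⟨ +-comm (length (postfixRL u)) _ ⟩
  length (postfixRL l) + 1 + length (postfixRL u)         ≡⟨ cong₂ (λ a b → a + 1 + b) (length-postfixRL l) (length-postfixRL u) ⟩
  size (shape l) + 1 + size (shape u)                     ∎
  where open ≡-Reasoning

size-shape-bst : ∀ w → size (shape (bst w)) ≡ length w
size-shape-bst w = trans (sym (length-postfixRL (bst w))) (↭-length (postfixRL-bst w))

atMost-++ : ∀ {x} w v → All (x <_) w → All (_≤ x) v → atMost x (w ++ v) ≡ v
atMost-++ {x} w v w>x v≤x = begin
  atMost x (w ++ v)         ≡⟨ filter-++ (_≤? x) w v ⟩
  atMost x w ++ atMost x v  ≡⟨ cong₂ _++_ (filter-none (_≤? x) (All.map <⇒≱ w>x)) (filter-all (_≤? x) v≤x) ⟩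
  v                         ∎
  where open ≡-Reasoning

above-++ : ∀ {x} w v → All (x <_) w → All (_≤ x) v → above x (w ++ v) ≡ w
above-++ {x} w v w>x v≤x = begin
  above x (w ++ v)        ≡⟨ filter-++ (∁? (_≤? x)) w v ⟩
  above x w ++ above x v  ≡⟨ cong₂ _++_ (filter-all (∁? (_≤? x)) (All.map <⇒≱ w>x))
                                        (filter-none (∁? (_≤? x)) (All.map (λ y≤x y≰x → y≰x y≤x) v≤x)) ⟩
  w ++ []                 ≡⟨ ++-identityʳ w ⟩
  w                       ∎
  where open ≡-Reasoning

≤lex-refl : ∀ w → w ≤lex w
≤lex-refl []      = []≤
≤lex-refl (x ∷ w) = head≡ (≤lex-refl w)

++-monoˡ-≤lex : ∀ {u v} z → u ≤lex v → length u ≡ length v → (u ++ z) ≤lex (v ++ z)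
++-monoˡ-≤lex {[]} {[]} z []≤         _       = ≤lex-refl z
++-monoˡ-≤lex           z (head< x<y) _       = head< x<y
++-monoˡ-≤lex           z (head≡ u≤v) |u|≡|v| = head≡ (++-monoˡ-≤lex z u≤v (suc-injective |u|≡|v|))

-- Every letter of v exceeds r, so the first letter ≤ r of xs that is compared with a letter of v
-- already makes xs smaller; the length hypothesis lets v run out exactly when above r xs does.
interleave-≤lex : ∀ r xs {v w u} → above r xs ≤lex v → length (above r xs) ≡ length v → All (r <_) v
                → (atMost r xs ++ u) ≤lex w → (xs ++ u) ≤lex (v ++ w)
interleave-≤lex r []       {[]}    _ _ _ lo≤w = lo≤w
interleave-≤lex r []       {_ ∷ _} _ () _ _
interleave-≤lex r (x ∷ xs) hi≤v |hi|≡|v| v>r lo≤w with x ≤ᵇ r | ≤ᵇ-reflects-≤ x r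
interleave-≤lex r (x ∷ xs) {[]}     hi≤v |hi|≡|v| [] (head< x<y) | true | _ = head< x<y
interleave-≤lex r (x ∷ xs) {[]}     hi≤v |hi|≡|v| [] (head≡ lo≤w) | true | _ =
  head≡ (interleave-≤lex r xs hi≤v |hi|≡|v| [] lo≤w)
interleave-≤lex r (x ∷ xs) {y ∷ v}  _ _ (r<y ∷ _) _ | true | ofʸ x≤r = head< (≤-<-trans x≤r r<y)
interleave-≤lex r (x ∷ xs) {[]}     () _ _ _ | false | _
interleave-≤lex r (x ∷ xs) {y ∷ v}  (head< x<y) _ _ _ | false | _ = head< x<y
interleave-≤lex r (x ∷ xs) {.x ∷ v} (head≡ hi≤v) |hi|≡|v| (_ ∷ v>r) lo≤w | false | _ =
  head≡ (interleave-≤lex r xs hi≤v (suc-injective |hi|≡|v|) v>r lo≤w)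

bst≡⇒≤lex-postfixRL : ∀ t σ → bst σ ≡ t → σ ≤lex postfixRL t
bst≡⇒≤lex-postfixRL t σ eq with initLast σ
bst≡⇒≤lex-postfixRL lleaf         .[]        eq | []       = []≤
bst≡⇒≤lex-postfixRL (lnode l r u) .[]        () | []
bst≡⇒≤lex-postfixRL lleaf         .(ys ∷ʳ x) eq | ys ∷ʳ′ x with () ← trans (sym (bst-∷ʳ ys x)) eq
bst≡⇒≤lex-postfixRL (lnode l r u) .(ys ∷ʳ x) eq | ys ∷ʳ′ x
  with eqˡ , refl , eqᵘ ← lnode-injective (trans (sym (bst-∷ʳ ys x)) eq) =
  interleave-≤lex x ys (bst≡⇒≤lex-postfixRL u (above x ys) eqᵘ) (sym (↭-length u↭hi)) u>x
    (++-monoˡ-≤lex [ x ] (bst≡⇒≤lex-postfixRL l (atMost x ys) eqˡ) (sym (↭-length l↭lo)))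
  where
  u↭hi : postfixRL u ↭ above x ys
  u↭hi = subst (λ t → postfixRL t ↭ above x ys) eqᵘ (postfixRL-bst (above x ys))
  l↭lo : postfixRL l ↭ atMost x ys
  l↭lo = subst (λ t → postfixRL t ↭ atMost x ys) eqˡ (postfixRL-bst (atMost x ys))
  u>x : All (x <_) (postfixRL u)
  u>x = All-resp-↭ (↭-sym u↭hi) (All.map ≰⇒> (all-filter (∁? (_≤? x)) ys))

interval : ℕ → ℕ → List ℕ
interval k zero    = []
interval k (suc n) = suc k ∷ interval (suc k) n

length-interval : ∀ k n → length (interval k n) ≡ n
length-interval k zero    = refl
length-interval k (suc n) = cong suc (length-interval (suc k) n)

applyUpTo-interval : ∀ f k n → (∀ i → f i ≡ suc (k + i)) → applyUpTo f n ≡ interval k n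
applyUpTo-interval f k zero    _  = refl
applyUpTo-interval f k (suc n) f≗ =
  cong₂ _∷_ (trans (f≗ 0) (cong suc (+-identityʳ k)))
            (applyUpTo-interval (λ i → f (suc i)) (suc k) n (λ i → trans (f≗ (suc i)) (cong suc (+-suc k i))))

upTo-interval : ∀ n → map suc (upTo n) ≡ interval 0 n
upTo-interval n = trans (map-upTo suc n) (applyUpTo-interval suc 0 n (λ _ → refl))

m+0+1≡1+m : ∀ m → m + 0 + 1 ≡ suc m
m+0+1≡1+m m = trans (cong (_+ 1) (+-identityʳ m)) (+-comm m 1)

interval-++ : ∀ k a b → interval k (a + 1 + b) ≡ interval k a ++ (k + a + 1) ∷ interval (k + a + 1) b
interval-++ k zero    b rewrite m+0+1≡1+m k = refl
interval-++ k (suc a) b rewrite +-suc k a = cong (suc k ∷_) (interval-++ (suc k) a b)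

∈-interval⁻ : ∀ k n {x} → x ∈ interval k n → ∃₂ λ a b → n ≡ a + 1 + b × x ≡ k + a + 1
∈-interval⁻ k (suc n) (here refl) = 0 , n , refl , sym (m+0+1≡1+m k)
∈-interval⁻ k (suc n) (there x∈) with a , b , refl , refl ← ∈-interval⁻ (suc k) n x∈ =
  suc a , b , refl , cong (_+ 1) (sym (+-suc k a))

interval-> : ∀ k n → All (k <_) (interval k n)
interval-> k zero    = []
interval-> k (suc n) = n<1+n k ∷ All.map (<-trans (n<1+n k)) (interval-> (suc k) n)

interval-≤ : ∀ k n → All (_≤ k + n) (interval k n)
interval-≤ k zero    = []
interval-≤ k (suc n) rewrite +-suc k n = s≤s (m≤m+n k n) ∷ interval-≤ (suc k) n

interval-≤-next : ∀ k n → All (_≤ k + n + 1) (interval k n)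
interval-≤-next k n = All.map (λ y≤k+n → ≤-trans y≤k+n (m≤m+n (k + n) 1)) (interval-≤ k n)

postfixRL-label-↭ : ∀ k T → postfixRL (label k T) ↭ interval k (size T)
postfixRL-label-↭ k leaf       = ↭-refl
postfixRL-label-↭ k (node L R) = begin
  wR ++ wL ++ [ x ]                               ↭⟨ ++-comm wR (wL ++ [ x ]) ⟩
  (wL ++ [ x ]) ++ wR                             ≡⟨ ++-assoc wL [ x ] wR ⟩
  wL ++ x ∷ wR                                    ↭⟨ ++⁺ (postfixRL-label-↭ k L) (prep x (postfixRL-label-↭ x R)) ⟩
  interval k (size L) ++ x ∷ interval x (size R)  ≡⟨ interval-++ k (size L) (size R) ⟨
  interval k (size L + 1 + size R)                ∎
  where
  open PermutationReasoning
  x = k + size L + 1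
  wL = postfixRL (label k L)
  wR = postfixRL (label x R)

bst-postfixRL-label : ∀ k T → bst (postfixRL (label k T)) ≡ label k T
bst-postfixRL-label k leaf       = refl
bst-postfixRL-label k (node L R) = begin
  bst (wR ++ wL ++ [ x ])                                          ≡⟨ cong bst (++-assoc wR wL [ x ]) ⟨
  bst ((wR ++ wL) ∷ʳ x)                                            ≡⟨ bst-∷ʳ (wR ++ wL) x ⟩
  lnode (bst (atMost x (wR ++ wL))) x (bst (above x (wR ++ wL)))  ≡⟨ cong₂ (λ v w → lnode (bst v) x (bst w))
                                                                            (atMost-++ wR wL wR>x wL≤x) (above-++ wR wL wR>x wL≤x) ⟩
  lnode (bst wL) x (bst wR)                                        ≡⟨ cong₂ (λ l u → lnode l x u)
                                                                            (bst-postfixRL-label k L) (bst-postfixRL-label x R) ⟩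
  label k (node L R)                                               ∎
  where
  open ≡-Reasoning
  x = k + size L + 1
  wL = postfixRL (label k L)
  wR = postfixRL (label x R)
  wR>x : All (x <_) wR
  wR>x = All-resp-↭ (↭-sym (postfixRL-label-↭ x R)) (interval-> x (size R))
  wL≤x : All (_≤ x) wL
  wL≤x = All-resp-↭ (↭-sym (postfixRL-label-↭ k L)) (interval-≤-next k (size L))

shape-label : ∀ k T → shape (label k T) ≡ T
shape-label k leaf       = refl
shape-label k (node L R) = cong₂ node (shape-label k L) (shape-label (k + size L + 1) R)

shape≡leaf⇒≡lleaf : ∀ t → shape t ≡ leaf → t ≡ lleaf
shape≡leaf⇒≡lleaf lleaf refl = refl

↭-interval-split : ∀ k a b ys → ys ∷ʳ (k + a + 1) ↭ interval k (a + 1 + b)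
                 → atMost (k + a + 1) ys ↭ interval k a × above (k + a + 1) ys ↭ interval (k + a + 1) b
↭-interval-split k a b ys p =
  subst (atMost x ys ↭_) (atMost-++ (interval x b) (interval k a) (interval-> x b) (interval-≤-next k a))
        (filter-↭ (_≤? x) ys↭) ,
  subst (above x ys ↭_) (above-++ (interval x b) (interval k a) (interval-> x b) (interval-≤-next k a))
        (filter-↭ (∁? (_≤? x)) ys↭)
  where
  x = k + a + 1
  ys↭ : ys ↭ interval x b ++ interval k a
  ys↭ = ↭-trans (subst (_↭ interval k a ++ interval x b) (++-identityʳ ys)
                       (drop-mid ys (interval k a) (subst (ys ∷ʳ x ↭_) (interval-++ k a b) p)))
                (++-comm (interval k a) (interval x b))

↭-interval⇒size : ∀ {k a w T} → w ↭ interval k a → shape (bst w) ≡ T → a ≡ size T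
↭-interval⇒size {k} {a} {w} w↭ refl =
  trans (sym (length-interval k a)) (trans (sym (↭-length w↭)) (sym (size-shape-bst w)))

bst≡label : ∀ T k σ → σ ↭ interval k (size T) → shape (bst σ) ≡ T → bst σ ≡ label k T
bst≡label leaf k σ _ e = shape≡leaf⇒≡lleaf (bst σ) e
bst≡label (node L R) k σ p e with initLast σ
bst≡label (node L R) k .[] p () | []
bst≡label (node L R) k .(ys ∷ʳ x) p e | ys ∷ʳ′ x
  with a , b , n≡ , refl ← ∈-interval⁻ k (size L + 1 + size R) (∈-resp-↭ p (∈-++⁺ʳ ys (here refl)))
  with lo , hi ← ↭-interval-split k a b ys (subst (λ n → ys ∷ʳ x ↭ interval k n) n≡ p)
  with eL , eR ← node-injective (trans (cong shape (sym (bst-∷ʳ ys x))) e)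
  with refl ← ↭-interval⇒size lo eL
  with refl ← ↭-interval⇒size hi eR =
  trans (bst-∷ʳ ys x) (cong₂ (λ l u → lnode l x u) (bst≡label L k _ lo eL) (bst≡label R x _ hi eR))

mainTheorem4 : (T : Tree) →
    InClass T (wT T) × ((σ : List ℕ) → InClass T σ → σ ≤lex wT T)
mainTheorem4 T = (wT-perm , wT-shape) , wT-greatest
  where
  wT-perm : IsPerm (size T) (wT T)
  wT-perm = subst (wT T ↭_) (sym (upTo-interval (size T))) (postfixRL-label-↭ 0 T)
  wT-shape : shape (bst (wT T)) ≡ T
  wT-shape = trans (cong shape (bst-postfixRL-label 0 T)) (shape-label 0 T)
  wT-greatest : (σ : List ℕ) → InClass T σ → σ ≤lex wT T
  wT-greatest σ (σ-perm , σ-shape) =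
    bst≡⇒≤lex-postfixRL (label 0 T) σ
      (bst≡label T 0 σ (subst (σ ↭_) (upTo-interval (size T)) σ-perm) σ-shape)
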